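{- Let $n\ge1$ and consider the path graph on nodes $0,1,\dots,n$ with edges $\{i,i+1\}$, $0\le i\le n-1$. Let $(X_m)_{m\ge0}$ be generated by the negative feedback algorithm with $X_0=0$. Then the number of times $m\ge1$ with $X_m=0$ that occur before the first time the walk visits node $n$ is at most $n-1$.
   Context: Negative feedback algorithm: for an edge from $i$ to $j$, let $N_{ij}^{(m)}$ be the number of times $t<m$ with $X_t=i,X_{t+1}=j$. Let $Smin_i^{(m)}$ be the set of neighbours $j$ of $i$ minimizing $N_{ij}^{(m)}$. If $X_m=i$, then given the past, $X_{m+1}$ is uniformly distributed on $Smin_i^{(m)}$. -}

module Defs where

open import Data.Nat using (ℕ; zero; suc; _+_; _≤_; _≟_)
open import Data.List using (List; length; filter; upTo)
open import Data.Product using (_×_)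
open import Data.Sum using (_⊎_)
open import Relation.Nullary.Decidable using (_×-dec_)
open import Relation.Binary.PropositionalEquality using (_≡_)

PathAdj : ℕ → ℕ → ℕ → Set
PathAdj n i j = (j ≡ suc i × suc i ≤ n) ⊎ (i ≡ suc j)

N : (ℕ → ℕ) → ℕ → ℕ → ℕ → ℕ
N X i j m = length (filter (λ t → (X t ≟ i) ×-dec (X (suc t) ≟ j)) (upTo m))

-- X is a possible trajectory of the negative feedback algorithm on the path graph:
-- at every step m, X (m+1) lies in Smin_{X m}^{(m)}, i.e. it is a neighbour of X m
-- minimising N_{X m, ·}^{(m)} among all neighbours of X m.
NegFeedbackPath : ℕ → (ℕ → ℕ) → Set
NegFeedbackPath n X =
  (m : ℕ) → PathAdj n (X m) (X (suc m))
          × ((k : ℕ) → PathAdj n (X m) k → N X (X m) (X (suc m)) m ≤ N X (X m) k m)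

-- #{ 1 ≤ m ≤ T : X m = 0 }
returnsTo0 : (ℕ → ℕ) → ℕ → ℕ
returnsTo0 X T = length (filter (λ m → X (suc m) ≟ 0) (upTo T))

{-# OPTIONS --safe #-}
module Submission where

-- Two invariants drive the bound.  Since the walk starts at 0, every edge {i, i+1}
-- has been crossed rightwards once more than leftwards while the walk is to its
-- right, and equally often otherwise.  At an interior node v the rule "leave along
-- the less used edge" keeps the departures v → v-1 and v → v+1 within one of each
-- other, with a surplus of leftward departures only while the walk is not right of v.
-- Together they give N(v → v-1) ≤ 1 + N(v+1 → v).  The returns to 0 are exactly the
-- steps 1 → 0, and chaining this bound up to the never used edge (n → n-1) gives
-- N(1 → 0) ≤ n - 1.

open import Defs
open import Data.Nat using (ℕ; zero; suc; _≤_; _<_; _∸_; _+_; z≤n; s≤s)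
open import Data.Nat.Properties
open import Data.List using (_∷_; []; length; filter; upTo; _++_)
open import Data.List.Properties using (upTo-∷ʳ; filter-++; length-++; filter-accept; filter-reject)
open import Data.Product using (_×_; _,_; proj₁; proj₂)
open import Data.Sum using (inj₁; inj₂)
open import Data.Empty using (⊥-elim)
open import Function using (_∘_)
open import Relation.Unary using (Decidable)
open import Relation.Binary.PropositionalEquality
open import Relation.Nullary using (¬_; yes; no)
open import Relation.Nullary.Decidable using (_×-dec_)

module _ {P : ℕ → Set} (P? : Decidable P) where

  countBelow : ℕ → ℕ
  countBelow m = length (filter P? (upTo m))

  countBelow-suc : ∀ m → countBelow (suc m) ≡ countBelow m + length (filter P? (m ∷ []))
  countBelow-suc m = begin
    length (filter P? (upTo (suc m)))                  ≡⟨ cong (length ∘ filter P?) (upTo-∷ʳ m) ⟨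
    length (filter P? (upTo m ++ m ∷ []))              ≡⟨ cong length (filter-++ P? (upTo m) (m ∷ [])) ⟩
    length (filter P? (upTo m) ++ filter P? (m ∷ []))  ≡⟨ length-++ (filter P? (upTo m)) ⟩
    countBelow m + length (filter P? (m ∷ []))         ∎
    where open ≡-Reasoning

  countBelow-suc-accept : ∀ {m} → P m → countBelow (suc m) ≡ suc (countBelow m)
  countBelow-suc-accept {m} p = begin
    countBelow (suc m)                          ≡⟨ countBelow-suc m ⟩
    countBelow m + length (filter P? (m ∷ []))  ≡⟨ cong (λ l → countBelow m + length l) (filter-accept P? p) ⟩
    countBelow m + 1                            ≡⟨ +-comm (countBelow m) 1 ⟩
    suc (countBelow m)                          ∎
    where open ≡-Reasoning

  countBelow-suc-reject : ∀ {m} → ¬ P m → countBelow (suc m) ≡ countBelow m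
  countBelow-suc-reject {m} ¬p = begin
    countBelow (suc m)                          ≡⟨ countBelow-suc m ⟩
    countBelow m + length (filter P? (m ∷ []))  ≡⟨ cong (λ l → countBelow m + length l) (filter-reject P? ¬p) ⟩
    countBelow m + 0                            ≡⟨ +-identityʳ (countBelow m) ⟩
    countBelow m                                ∎
    where open ≡-Reasoning

module _ (X : ℕ → ℕ) {i j m : ℕ} where

  private
    traversal? : Decidable (λ t → X t ≡ i × X (suc t) ≡ j)
    traversal? t = (X t ≟ i) ×-dec (X (suc t) ≟ j)

  N-suc-hit : X m ≡ i → X (suc m) ≡ j → N X i j (suc m) ≡ suc (N X i j m)
  N-suc-hit p q = countBelow-suc-accept traversal? (p , q)

  N-suc-miss : ∀ {x y} → X m ≡ x → X (suc m) ≡ y → ¬ (x ≡ i × y ≡ j) → N X i j (suc m) ≡ N X i j m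
  N-suc-miss p q ¬xy = countBelow-suc-reject traversal? (λ (p′ , q′) → ¬xy (trans (sym p) p′ , trans (sym q) q′))

N-unvisited : ∀ X i j m → (∀ t → t < m → X t ≢ i) → N X i j m ≡ 0
N-unvisited X i j zero    _       = refl
N-unvisited X i j (suc m) avoids =
  trans (N-suc-miss X refl refl (λ (p , _) → avoids m ≤-refl p))
        (N-unvisited X i j m (λ t t<m → avoids t (m≤n⇒m≤1+n t<m)))

data Adjacent : ℕ → ℕ → Set where
  up   : ∀ {x} → Adjacent x (suc x)
  down : ∀ {x} → Adjacent (suc x) x

PathAdj⇒Adjacent : ∀ {n x y} → PathAdj n x y → Adjacent x y
PathAdj⇒Adjacent (inj₁ (refl , _)) = up
PathAdj⇒Adjacent (inj₂ refl)       = down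

Adjacent-to-0 : ∀ {x} → Adjacent x 0 → x ≡ 1
Adjacent-to-0 down = refl

NearestNeighbourWalk : (ℕ → ℕ) → Set
NearestNeighbourWalk X = ∀ m → Adjacent (X m) (X (suc m))

NegFeedbackPath⇒NearestNeighbourWalk : ∀ {n X} → NegFeedbackPath n X → NearestNeighbourWalk X
NegFeedbackPath⇒NearestNeighbourWalk H m = PathAdj⇒Adjacent (proj₁ (H m))

returnsTo0≡N : ∀ X → NearestNeighbourWalk X → ∀ T → returnsTo0 X T ≡ N X 1 0 T
returnsTo0≡N X walk zero    = refl
returnsTo0≡N X walk (suc m) with X (suc m) ≟ 0
... | yes q = begin
  returnsTo0 X (suc m)  ≡⟨ countBelow-suc-accept (λ t → X (suc t) ≟ 0) q ⟩
  suc (returnsTo0 X m)  ≡⟨ cong suc (returnsTo0≡N X walk m) ⟩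
  suc (N X 1 0 m)       ≡⟨ N-suc-hit X (Adjacent-to-0 (subst (Adjacent (X m)) q (walk m))) q ⟨
  N X 1 0 (suc m)       ∎
  where open ≡-Reasoning
... | no ¬q = begin
  returnsTo0 X (suc m)  ≡⟨ countBelow-suc-reject (λ t → X (suc t) ≟ 0) ¬q ⟩
  returnsTo0 X m        ≡⟨ returnsTo0≡N X walk m ⟩
  N X 1 0 m             ≡⟨ N-suc-miss X refl refl (¬q ∘ proj₂) ⟨
  N X 1 0 (suc m)       ∎
  where open ≡-Reasoning

-- f and b count the crossings i → i+1 and i+1 → i, and x is the current position.
CrossingBalance : (i x f b : ℕ) → Set
CrossingBalance i x f b = (i < x → f ≡ suc b) × (x ≤ i → f ≡ b)

crossingBalance-step : ∀ X i m {x y} → X m ≡ x → X (suc m) ≡ y → Adjacent x y →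
  CrossingBalance i x (N X i (suc i) m) (N X (suc i) i m) →
  CrossingBalance i y (N X i (suc i) (suc m)) (N X (suc i) i (suc m))
crossingBalance-step X i m p q (up {x}) (right , left) with x ≟ i
... | yes refl
  = subst₂ (CrossingBalance i (suc i)) (sym (N-suc-hit X p q)) (sym (N-suc-miss X p q (λ { (() , _) })))
      ((λ _ → cong suc (left ≤-refl)) , (λ i+1≤i → ⊥-elim (1+n≰n i+1≤i)))
... | no x≢i
  = subst₂ (CrossingBalance i (suc x)) (sym (N-suc-miss X p q (λ (e , _) → x≢i e)))
                                        (sym (N-suc-miss X p q (λ { (refl , ()) })))
      ((λ i<x+1 → right (≤∧≢⇒< (≤-pred i<x+1) (x≢i ∘ sym))) , (λ x<i → left (<⇒≤ x<i)))
crossingBalance-step X i m p q (down {x}) (right , left) with x ≟ i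
... | yes refl
  = subst₂ (CrossingBalance i i) (sym (N-suc-miss X p q (λ { (() , _) }))) (sym (N-suc-hit X p q))
      ((λ i<i → ⊥-elim (<-irrefl refl i<i)) , (λ _ → right (n<1+n i)))
... | no x≢i
  = subst₂ (CrossingBalance i x) (sym (N-suc-miss X p q (λ { (refl , ()) })))
                                  (sym (N-suc-miss X p q (λ (_ , e) → x≢i e)))
      ((λ i<x → right (m≤n⇒m≤1+n i<x)) , (λ x≤i → left (≤∧≢⇒< x≤i x≢i)))

crossingBalance : ∀ X → X 0 ≡ 0 → NearestNeighbourWalk X →
  ∀ i m → CrossingBalance i (X m) (N X i (suc i) m) (N X (suc i) i m)
crossingBalance X X0≡0 walk i zero =
  (λ i<X0 → ⊥-elim (n≮0 (subst (i <_) X0≡0 i<X0))) , (λ _ → refl)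
crossingBalance X X0≡0 walk i (suc m) =
  crossingBalance-step X i m refl refl (walk m) (crossingBalance X X0≡0 walk i m)

-- l and r count the departures from the node k+1 to k and to k+2, and x is the
-- current position.  A surplus of leftward departures means the last departure
-- went left, so the walk has not come back to k+1 since.
DepartureBalance : (k x l r : ℕ) → Set
DepartureBalance k x l r = (x ≤ suc k → l ≤ suc r) × (suc k < x → l ≤ r) × (r ≤ suc l)

module _ {n X} (H : NegFeedbackPath n X) {k} (k+2≤n : suc (suc k) ≤ n) where

  departureBalance-step : ∀ m {x y} → X m ≡ x → X (suc m) ≡ y → Adjacent x y →
    DepartureBalance k x (N X (suc k) k m) (N X (suc k) (suc (suc k)) m) →
    DepartureBalance k y (N X (suc k) k (suc m)) (N X (suc k) (suc (suc k)) (suc m))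
  departureBalance-step m p q (up {x}) (near , far , r≤l+1) with x ≟ suc k
  ... | yes refl
    = subst₂ (DepartureBalance k (suc (suc k))) (sym (N-suc-miss X p q (λ { (_ , ()) })))
                                                (sym (N-suc-hit X p q))
        ((λ k+2≤k+1 → ⊥-elim (1+n≰n k+2≤k+1)) , (λ _ → near ≤-refl) , s≤s right-minimal)
    where
      right-minimal : N X (suc k) (suc (suc k)) m ≤ N X (suc k) k m
      right-minimal = subst₂ (λ a b → N X a b m ≤ N X a k m) p q (proj₂ (H m) k (inj₂ p))
  ... | no x≢k+1
    = subst₂ (DepartureBalance k (suc x)) (sym (N-suc-miss X p q (λ (e , _) → x≢k+1 e)))
                                          (sym (N-suc-miss X p q (λ (e , _) → x≢k+1 e)))
        ( (λ x<k+1 → near (<⇒≤ x<k+1))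
        , (λ k+1<x+1 → far (≤∧≢⇒< (≤-pred k+1<x+1) (x≢k+1 ∘ sym)))
        , r≤l+1 )
  departureBalance-step m p q (down {x}) (near , far , r≤l+1) with x ≟ k
  ... | yes refl
    = subst₂ (DepartureBalance k k) (sym (N-suc-hit X p q)) (sym (N-suc-miss X p q (λ { (_ , ()) })))
        ( (λ _ → s≤s left-minimal)
        , (λ k+1<k → ⊥-elim (1+n≰n (m≤n⇒m≤1+n k+1<k)))
        , m≤n⇒m≤1+n r≤l+1 )
    where
      right-neighbour : PathAdj n (X m) (suc (suc k))
      right-neighbour = inj₁ (cong suc (sym p) , subst (λ z → suc z ≤ n) (sym p) k+2≤n)

      left-minimal : N X (suc k) k m ≤ N X (suc k) (suc (suc k)) m
      left-minimal = subst₂ (λ a b → N X a b m ≤ N X a (suc (suc k)) m) p q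
                       (proj₂ (H m) (suc (suc k)) right-neighbour)
  ... | no x≢k
    = subst₂ (DepartureBalance k x) (sym (N-suc-miss X p q (λ (e , _) → x≢k (suc-injective e))))
                                    (sym (N-suc-miss X p q (λ (e , _) → x≢k (suc-injective e))))
        ((λ _ → near-or-far) , (λ k+1<x → far (m≤n⇒m≤1+n k+1<x)) , r≤l+1)
    where
      near-or-far : N X (suc k) k m ≤ suc (N X (suc k) (suc (suc k)) m)
      near-or-far with x ≤? k
      ... | yes x≤k = near (s≤s x≤k)
      ... | no x≰k  = m≤n⇒m≤1+n (far (s≤s (≰⇒> x≰k)))

  departureBalance : ∀ m → DepartureBalance k (X m) (N X (suc k) k m) (N X (suc k) (suc (suc k)) m)
  departureBalance zero    = (λ _ → z≤n) , (λ _ → z≤n) , z≤n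
  departureBalance (suc m) =
    departureBalance-step m refl refl (NegFeedbackPath⇒NearestNeighbourWalk H m) (departureBalance m)

  leftward-step-bound : X 0 ≡ 0 → ∀ T → N X (suc k) k T ≤ suc (N X (suc (suc k)) (suc k) T)
  leftward-step-bound X0≡0 T
    with crossingBalance X X0≡0 (NegFeedbackPath⇒NearestNeighbourWalk H) (suc k) T
       | departureBalance T | X T ≤? suc k
  ... | (_ , left) | (near , _ , _) | yes XT≤k+1 =
    subst (λ c → N X (suc k) k T ≤ suc c) (left XT≤k+1) (near XT≤k+1)
  ... | (right , _) | (_ , far , _) | no XT≰k+1 =
    subst (N X (suc k) k T ≤_) (right (≰⇒> XT≰k+1)) (far (≰⇒> XT≰k+1))

returns-bound : ∀ n X → X 0 ≡ 0 → NegFeedbackPath n X →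
  ∀ T j → suc j ≤ n → N X 1 0 T ≤ j + N X (suc j) j T
returns-bound n X X0≡0 H T zero    _     = ≤-refl
returns-bound n X X0≡0 H T (suc j) j+2≤n = begin
  N X 1 0 T                                ≤⟨ returns-bound n X X0≡0 H T j (≤-trans (n≤1+n _) j+2≤n) ⟩
  j + N X (suc j) j T                      ≤⟨ +-monoʳ-≤ j (leftward-step-bound H j+2≤n X0≡0 T) ⟩
  j + suc (N X (suc (suc j)) (suc j) T)    ≡⟨ +-suc j _ ⟩
  suc j + N X (suc (suc j)) (suc j) T      ∎
  where open ≤-Reasoning

lemma1 : (n : ℕ) → 1 ≤ n → (X : ℕ → ℕ) → X 0 ≡ 0 → NegFeedbackPath n X →
         (T : ℕ) → ((k : ℕ) → k ≤ T → ¬ (X k ≡ n)) → returnsTo0 X T ≤ n ∸ 1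
lemma1 (suc j) _ X X0≡0 H T avoids-n = begin
  returnsTo0 X T       ≡⟨ returnsTo0≡N X (NegFeedbackPath⇒NearestNeighbourWalk H) T ⟩
  N X 1 0 T            ≤⟨ returns-bound (suc j) X X0≡0 H T j ≤-refl ⟩
  j + N X (suc j) j T  ≡⟨ cong (j +_) (N-unvisited X (suc j) j T (λ t t<T → avoids-n t (<⇒≤ t<T))) ⟩
  j + 0                ≡⟨ +-identityʳ j ⟩
  j                    ∎
  where open ≤-Reasoning
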